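{- Let $\mathbf{L}=\langle L,\leq\rangle$ be a complete lattice, $M\subseteq L$, and $S$ an $L$-parameterization. For any $a\in L$, $C_M(a)\in D_M(a)$, i.e., $M\models a\Rightarrow C_M(a)$.
   Context: An isotone Galois connection in $\mathbf{L}$ is a pair $\langle f,h\rangle$ of maps $L\to L$ with $f(a)\leq b$ iff $a\leq h(b)$; composition $\langle f_1,h_1\rangle\circ\langle f_2,h_2\rangle=\langle f_1f_2,h_2h_1\rangle$. An $L$-parameterization is a set $S$ of isotone Galois connections containing $\langle\mathrm{id},\mathrm{id}\rangle$. For $a,b\in L$, $M\models a\Rightarrow b$ means: for all $m\in M$ and every $\langle f,h\rangle$ that is a finite composition $\langle f_1,h_1\rangle\circ\cdots\circ\langle f_n,h_n\rangle$ of elements of $S$, $f(a)\leq m$ implies $f(b)\leq m$. $D_M(a)=\{b\in L;\ M\models a\Rightarrow b\}$ and $C_M(a)=\bigvee D_M(a)$. -}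

module Defs where

open import Level using (Level; suc)
open import Data.Product using (_×_; Σ; _,_)
open import Function using (_∘_; id)
open import Relation.Unary using (Pred; _∈_)
open import Relation.Binary.Bundles using (Poset)

record CompleteLattice (ℓ : Level) : Set (suc ℓ) where
  field
    poset : Poset ℓ ℓ ℓ
  open Poset poset public
  field
    ⋁       : Pred Carrier ℓ → Carrier
    ⋁-upper : ∀ (P : Pred Carrier ℓ) x → P x → x ≤ ⋁ P
    ⋁-least : ∀ (P : Pred Carrier ℓ) y → (∀ x → P x → x ≤ y) → ⋁ P ≤ y

module _ {ℓ : Level} (𝐋 : CompleteLattice ℓ) where
  open CompleteLattice 𝐋

  record GaloisConn : Set ℓ where
    constructor ⟨_,_⟩∶_
    field
      f : Carrier → Carrier
      h : Carrier → Carrier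
      galois : ∀ a b → (f a ≤ b → a ≤ h b) × (a ≤ h b → f a ≤ b)

  idGC : GaloisConn
  idGC = ⟨ id , id ⟩∶ (λ a b → id , id)

  record Parameterization : Set (suc ℓ) where
    field
      S    : Pred GaloisConn ℓ
      idIn : idGC ∈ S

  data Comp (S : Pred GaloisConn ℓ) : (Carrier → Carrier) → (Carrier → Carrier) → Set ℓ where
    base : ∀ (g : GaloisConn) → g ∈ S → Comp S (GaloisConn.f g) (GaloisConn.h g)
    step : ∀ (g : GaloisConn) → g ∈ S → ∀ {f h} → Comp S f h →
           Comp S (GaloisConn.f g ∘ f) (h ∘ GaloisConn.h g)

  Entails : Parameterization → Pred Carrier ℓ → Carrier → Carrier → Set ℓ
  Entails P M a b = ∀ (m : Carrier) → m ∈ M → ∀ f h → Comp (Parameterization.S P) f h →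
                    f a ≤ m → f b ≤ m

  D : Parameterization → Pred Carrier ℓ → Carrier → Pred Carrier ℓ
  D P M a b = Entails P M a b

  C : Parameterization → Pred Carrier ℓ → Carrier → Carrier
  C P M a = ⋁ (D P M a)

-- Every composite ⟨f,h⟩ of elements of S is again a Galois connection. If f a ≤ m,
-- each b ∈ D_M(a) has f b ≤ m, i.e. b ≤ h m; so C_M(a) ≤ h m, i.e. f (C_M(a)) ≤ m.
module Submission where

open import Level using (Level)
open import Relation.Unary using (Pred; _∈_)
open import Data.Product using (_×_; _,_; proj₁; proj₂)
open import Defs

module _ {ℓ : Level} (𝐋 : CompleteLattice ℓ) where
  open CompleteLattice 𝐋

  IsGalois : (Carrier → Carrier) → (Carrier → Carrier) → Set ℓ
  IsGalois f h = ∀ a b → (f a ≤ b → a ≤ h b) × (a ≤ h b → f a ≤ b)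

  IsGalois-∘ : ∀ {f₁ h₁ f₂ h₂} → IsGalois f₁ h₁ → IsGalois f₂ h₂ →
               IsGalois (λ x → f₁ (f₂ x)) (λ x → h₂ (h₁ x))
  IsGalois-∘ {h₁ = h₁} {f₂ = f₂} g₁ g₂ a b =
    (λ f₁f₂a≤b → proj₁ (g₂ a (h₁ b)) (proj₁ (g₁ (f₂ a) b) f₁f₂a≤b)) ,
    (λ a≤h₂h₁b → proj₂ (g₁ (f₂ a) b) (proj₂ (g₂ a (h₁ b)) a≤h₂h₁b))

  Comp⇒IsGalois : ∀ {S f h} → Comp 𝐋 S f h → IsGalois f h
  Comp⇒IsGalois (base g _)   = GaloisConn.galois g
  Comp⇒IsGalois (step g _ c) = IsGalois-∘ (GaloisConn.galois g) (Comp⇒IsGalois c)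

  ⋁-IsGalois : ∀ {f h} → IsGalois f h → ∀ (P : Pred Carrier ℓ) m →
               (∀ b → P b → f b ≤ m) → f (⋁ P) ≤ m
  ⋁-IsGalois gal P m bound =
    proj₂ (gal (⋁ P) m) (⋁-least P _ (λ b Pb → proj₁ (gal b m) (bound b Pb)))

lemma25 : ∀ {ℓ : Level} (𝐋 : CompleteLattice ℓ) (S : Parameterization 𝐋)
    (M : Pred (CompleteLattice.Carrier 𝐋) ℓ) (a : CompleteLattice.Carrier 𝐋) →
    C 𝐋 S M a ∈ D 𝐋 S M a
lemma25 𝐋 S M a m m∈M f h c fa≤m =
  ⋁-IsGalois 𝐋 (Comp⇒IsGalois 𝐋 c) (D 𝐋 S M a) m
    (λ b a⇒b → a⇒b m m∈M f h c fa≤m)
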